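{- Let $d\ge 1$ and $k\ge 2$ be integers. The Hamming graph $H(d,k)$ admits a closed neighborhood balanced $k$-coloring if and only if $d\equiv 1 \pmod{k}$.
   Context: All graphs are finite and simple. For a vertex $v$ of a graph $G$, $N(v)$ is its set of neighbors and $N[v]=N(v)\cup\{v\}$ its closed neighborhood. For an integer $k\ge 2$, a closed neighborhood balanced $k$-coloring of $G$ is a map $c:V(G)\to\{1,\dots,k\}$ such that for every vertex $v$ the numbers $|N[v]\cap c^{ -1}(i)|$, $i=1,\dots,k$, are all equal. The Hamming graph $H(d,k)$ has vertex set $S^d$ where $S=\{1,\dots,k\}$, two $d$-tuples being adjacent iff they differ in exactly one coordinate. -}

module Defs where

open import Data.Nat using (ℕ; zero; suc; _+_; _≤_; _≤?_)
open import Data.Fin using (Fin)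
open import Data.Fin.Properties using (_≟_)
open import Data.Vec using (Vec; []; _∷_)
open import Data.List using (List; []; _∷_; concatMap; map; filter; length)
open import Data.List using (allFin)
open import Data.Product using (_×_)
open import Relation.Nullary.Decidable using (_×-dec_; yes; no)
open import Relation.Binary.PropositionalEquality using (_≡_)

HVertex : ℕ → ℕ → Set
HVertex d k = Vec (Fin k) d

allVertices : (d k : ℕ) → List (HVertex d k)
allVertices zero    k = [] ∷ []
allVertices (suc d) k =
  concatMap (λ a → map (a ∷_) (allVertices d k)) (allFin k)

hamming : {d k : ℕ} → HVertex d k → HVertex d k → ℕ
hamming []       []       = 0
hamming (a ∷ u) (b ∷ v) with a ≟ b
... | yes _ = hamming u v
... | no  _ = suc (hamming u v)

Adjacent : {d k : ℕ} → HVertex d k → HVertex d k → Set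
Adjacent u v = hamming u v ≡ 1

InClosedNbhd : {d k : ℕ} → HVertex d k → HVertex d k → Set
InClosedNbhd u v = hamming u v ≤ 1

closedNbhdColorCount : {d k : ℕ} → (HVertex d k → Fin k) → HVertex d k → Fin k → ℕ
closedNbhdColorCount {d} {k} c v i =
  length (filter (λ u → (hamming u v ≤? 1) ×-dec (c u ≟ i)) (allVertices d k))

IsCNBalancedColoring : (d k : ℕ) → (HVertex d k → Fin k) → Set
IsCNBalancedColoring d k c =
  (v : HVertex d k) (i j : Fin k) →
    closedNbhdColorCount c v i ≡ closedNbhdColorCount c v j

-- Summing the colour counts over N[v] gives |N[v]| = 1 + d(k − 1), so in a balanced colouring
-- k divides 1 + d(k − 1), i.e. k ∣ d − 1.  Conversely, for d = 1 + qk colour a vertex by the sum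
-- of its first t = 1 + q(k − 1) coordinates mod k.  Seen from v, the q(k − 1) neighbours that
-- change one of the last q coordinates keep the colour of v, while along each of the first t
-- coordinates the k vertices of the line through v take every colour once.  So colour i meets
-- N[v] in (1 + q(k − 1))·[c v = i] + t·(1 − [c v = i]) = t vertices, whatever i is.

module Submission where

open import Defs
open import Data.Nat using (ℕ; _≤_; _∸_)
open import Data.Nat.Divisibility using (_∣_)
open import Data.Fin using (Fin)
open import Data.Product using (∃)
open import Function.Bundles using (_⇔_)

open import Data.Bool using (Bool; true; false; if_then_else_; _∧_)
open import Data.Fin using (zero; suc; toℕ)
open import Data.Fin.Properties using (_≟_; toℕ-injective; toℕ-fromℕ<; toℕ<n)
open import Data.List using (List; []; _∷_; _++_; map; filter; length; concatMap; tabulate; allFin)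
open import Data.List.Properties using (map-++; map-∘; map-cong)
import Data.Nat.ListAction as List
open import Data.Nat.ListAction.Properties using (sum-++)
open import Data.Nat using (zero; suc; _+_; _*_; _≤?_)
open import Data.Nat.Properties
  using (+-0-commutativeMonoid; +-commutativeSemigroup; +-assoc; +-comm; +-identityʳ; +-suc;
         +-cancelʳ-≡; *-identityʳ; *-comm)
open import Data.Nat.Divisibility using (divides; ∣m+n∣m⇒∣n)
open import Data.Nat.DivMod using (_mod_; _%_; m<n⇒m%n≡m; [m+n]%n≡m%n)
open import Data.Nat.Tactic.RingSolver using (solve-∀)
open import Data.Product using (_,_)
open import Data.Vec using ([]; _∷_; replicate)
open import Function.Base using (_∘_)
open import Function.Bundles using (mk⇔)
open import Relation.Nullary using (Dec; does; yes; no; contradiction)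
open import Relation.Nullary.Decidable using (_×-dec_)
open import Relation.Binary.PropositionalEquality
open ≡-Reasoning

open import Algebra.Properties.CommutativeMonoid.Sum +-0-commutativeMonoid
  using (sum-syntax; sum-cong-≗; sum-replicate-zero; ∑-comm)
open import Algebra.Properties.CommutativeSemigroup +-commutativeSemigroup
  using (x∙yz≈y∙xz; xy∙z≈x∙zy; xy∙z≈xz∙y; xy∙z≈z∙yx)

when : Bool → ℕ → ℕ
when b x = if b then x else 0

when-∧ : ∀ a b x → when (a ∧ b) x ≡ when a (when b x)
when-∧ true  b x = refl
when-∧ false b x = refl

does-≟-sym : ∀ {n} (i j : Fin n) → does (i ≟ j) ≡ does (j ≟ i)
does-≟-sym i j with i ≟ j | j ≟ i
... | yes _    | yes _    = refl
... | no  _    | no  _    = refl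
... | yes i≡j  | no  j≢i  = contradiction (sym i≡j) j≢i
... | no  i≢j  | yes j≡i  = contradiction (sym j≡i) i≢j

∑-const : ∀ n x → ∑[ i < n ] x ≡ n * x
∑-const zero    x = refl
∑-const (suc n) x = cong (x +_) (∑-const n x)

∑-if-≟ : ∀ {n} (b : Fin n) (X Y : Fin n → ℕ) →
  ∑[ a < n ] (if does (a ≟ b) then X a else Y a) + Y b ≡ X b + ∑[ a < n ] Y a
∑-if-≟ zero X Y = xy∙z≈x∙zy (X zero) _ (Y zero)
∑-if-≟ (suc b) X Y = begin
  Y zero + ∑X/Y + Y (suc b)      ≡⟨ +-assoc (Y zero) ∑X/Y _ ⟩
  Y zero + (∑X/Y + Y (suc b))    ≡⟨ cong (Y zero +_) (∑-if-≟ b (X ∘ suc) (Y ∘ suc)) ⟩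
  Y zero + (X (suc b) + ∑Y)      ≡⟨ x∙yz≈y∙xz (Y zero) (X (suc b)) ∑Y ⟩
  X (suc b) + (Y zero + ∑Y)      ∎
  where
  ∑X/Y = ∑[ a < _ ] (if does (a ≟ b) then X (suc a) else Y (suc a))
  ∑Y   = ∑[ a < _ ] Y (suc a)

∑-when-≟ : ∀ {n} (b : Fin n) (X : Fin n → ℕ) → ∑[ a < n ] when (does (a ≟ b)) (X a) ≡ X b
∑-when-≟ {n} b X = begin
  ∑[ a < n ] when (does (a ≟ b)) (X a)      ≡⟨ +-identityʳ _ ⟨
  ∑[ a < n ] when (does (a ≟ b)) (X a) + 0  ≡⟨ ∑-if-≟ b X (λ _ → 0) ⟩
  X b + ∑[ a < n ] 0                        ≡⟨ cong (X b +_) (sum-replicate-zero n) ⟩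
  X b + 0                                   ≡⟨ +-identityʳ _ ⟩
  X b                                       ∎

Periodic : ℕ → (ℕ → ℕ) → Set
Periodic k F = ∀ n → F (n + k) ≡ F n

∑-telescope : ∀ n (G : ℕ → ℕ) → ∑[ a < n ] G (suc (toℕ a)) + G 0 ≡ ∑[ a < n ] G (toℕ a) + G n
∑-telescope zero    G = refl
∑-telescope (suc n) G = begin
  G 1 + ∑G₂ + G 0          ≡⟨ xy∙z≈z∙yx (G 1) ∑G₂ (G 0) ⟩
  G 0 + (∑G₂ + G 1)        ≡⟨ cong (G 0 +_) (∑-telescope n (G ∘ suc)) ⟩
  G 0 + (∑G₁ + G (suc n))  ≡⟨ +-assoc (G 0) ∑G₁ _ ⟨
  G 0 + ∑G₁ + G (suc n)    ∎
  where
  ∑G₁ = ∑[ a < n ] G (suc (toℕ a))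
  ∑G₂ = ∑[ a < n ] G (suc (suc (toℕ a)))

∑-periodic-shift : ∀ {k F} → Periodic k F → ∀ x → ∑[ a < k ] F (toℕ a + x) ≡ ∑[ a < k ] F (toℕ a)
∑-periodic-shift {k} {F} F-periodic zero = sum-cong-≗ {k} (λ a → cong F (+-identityʳ (toℕ a)))
∑-periodic-shift {k} {F} F-periodic (suc x) = begin
  ∑[ a < k ] F (toℕ a + suc x)    ≡⟨ sum-cong-≗ {k} (λ a → cong F (+-suc (toℕ a) x)) ⟩
  ∑[ a < k ] F (suc (toℕ a) + x)  ≡⟨ +-cancelʳ-≡ (F x) _ _ telescope ⟩
  ∑[ a < k ] F (toℕ a + x)        ≡⟨ ∑-periodic-shift F-periodic x ⟩
  ∑[ a < k ] F (toℕ a)            ∎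
  where
  telescope : ∑[ a < k ] F (suc (toℕ a) + x) + F x ≡ ∑[ a < k ] F (toℕ a + x) + F x
  telescope = trans (∑-telescope k (λ m → F (m + x)))
                    (cong (∑[ a < k ] F (toℕ a + x) +_) (trans (cong F (+-comm k x)) (F-periodic x)))

sum-map-concatMap : ∀ {A B : Set} (h : B → ℕ) (g : A → List B) xs →
  List.sum (map h (concatMap g xs)) ≡ List.sum (map (List.sum ∘ map h ∘ g) xs)
sum-map-concatMap h g []       = refl
sum-map-concatMap h g (x ∷ xs) = begin
  List.sum (map h (g x ++ concatMap g xs))
    ≡⟨ cong List.sum (map-++ h (g x) (concatMap g xs)) ⟩
  List.sum (map h (g x) ++ map h (concatMap g xs))
    ≡⟨ sum-++ (map h (g x)) _ ⟩
  List.sum (map h (g x)) + List.sum (map h (concatMap g xs))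
    ≡⟨ cong (List.sum (map h (g x)) +_) (sum-map-concatMap h g xs) ⟩
  List.sum (map h (g x)) + List.sum (map (List.sum ∘ map h ∘ g) xs)
    ∎

sum-map-tabulate : ∀ {A : Set} {n} (h : A → ℕ) (f : Fin n → A) →
  List.sum (map h (tabulate f)) ≡ ∑[ i < n ] h (f i)
sum-map-tabulate {n = zero}  h f = refl
sum-map-tabulate {n = suc n} h f = cong (h (f zero) +_) (sum-map-tabulate h (f ∘ suc))

length-filter≡sum : ∀ {A : Set} {P : A → Set} (P? : ∀ x → Dec (P x)) xs →
  length (filter P? xs) ≡ List.sum (map (λ x → when (does (P? x)) 1) xs)
length-filter≡sum P? []       = refl
length-filter≡sum P? (x ∷ xs) with does (P? x)
... | true  = cong suc (length-filter≡sum P? xs)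
... | false = length-filter≡sum P? xs

∑V : ∀ {d k} → (HVertex d k → ℕ) → ℕ
∑V {zero}      f = f []
∑V {suc d} {k} f = ∑[ a < k ] ∑V (λ u → f (a ∷ u))

sum-map-allVertices : ∀ d k (f : HVertex d k → ℕ) → List.sum (map f (allVertices d k)) ≡ ∑V f
sum-map-allVertices zero    k f = +-identityʳ (f [])
sum-map-allVertices (suc d) k f = begin
  List.sum (map f (concatMap (λ a → map (a ∷_) (allVertices d k)) (allFin k)))
    ≡⟨ sum-map-concatMap f _ (allFin k) ⟩
  List.sum (map (λ a → List.sum (map f (map (a ∷_) (allVertices d k)))) (allFin k))
    ≡⟨ sum-map-tabulate (λ a → List.sum (map f (map (a ∷_) (allVertices d k)))) (λ a → a) ⟩
  ∑[ a < k ] List.sum (map f (map (a ∷_) (allVertices d k)))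
    ≡⟨ sum-cong-≗ {k} (λ a → cong List.sum (map-∘ (allVertices d k))) ⟨
  ∑[ a < k ] List.sum (map (λ u → f (a ∷ u)) (allVertices d k))
    ≡⟨ sum-cong-≗ {k} (λ a → sum-map-allVertices d k (λ u → f (a ∷ u))) ⟩
  ∑[ a < k ] ∑V (λ u → f (a ∷ u))
    ∎

∑V-cong : ∀ {d k} {f g : HVertex d k → ℕ} → (∀ u → f u ≡ g u) → ∑V f ≡ ∑V g
∑V-cong {zero}  f≗g = f≗g []
∑V-cong {suc d} f≗g = sum-cong-≗ (λ a → ∑V-cong (λ u → f≗g (a ∷ u)))

∑V-zero : ∀ {d k} → ∑V {d} {k} (λ _ → 0) ≡ 0
∑V-zero {zero}      = refl
∑V-zero {suc d} {k} = trans (sum-cong-≗ {k} (λ _ → ∑V-zero {d})) (sum-replicate-zero k)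

∑-∑V-comm : ∀ {d k n} (h : Fin n → HVertex d k → ℕ) →
  ∑[ i < n ] ∑V (h i) ≡ ∑V (λ u → ∑[ i < n ] h i u)
∑-∑V-comm {zero}  h = refl
∑-∑V-comm {suc d} h =
  trans (∑-comm (λ i a → ∑V (λ u → h i (a ∷ u))))
        (sum-cong-≗ (λ a → ∑-∑V-comm (λ i u → h i (a ∷ u))))

ballSum : ∀ {d k} → ℕ → HVertex d k → (HVertex d k → ℕ) → ℕ
ballSum r v G = ∑V (λ u → when (does (hamming u v ≤? r)) (G u))

closedNbhdColorCount≡ballSum : ∀ {d k} (c : HVertex d k → Fin k) v i →
  closedNbhdColorCount c v i ≡ ballSum 1 v (λ u → when (does (c u ≟ i)) 1)
closedNbhdColorCount≡ballSum {d} {k} c v i = begin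
  length (filter (λ u → (hamming u v ≤? 1) ×-dec (c u ≟ i)) (allVertices d k))
    ≡⟨ length-filter≡sum _ (allVertices d k) ⟩
  List.sum (map (λ u → when (does (hamming u v ≤? 1) ∧ does (c u ≟ i)) 1) (allVertices d k))
    ≡⟨ cong List.sum (map-cong (λ u → when-∧ (does (hamming u v ≤? 1)) _ 1) (allVertices d k)) ⟩
  List.sum (map (λ u → when (does (hamming u v ≤? 1)) (when (does (c u ≟ i)) 1)) (allVertices d k))
    ≡⟨ sum-map-allVertices d k _ ⟩
  ballSum 1 v (λ u → when (does (c u ≟ i)) 1)
    ∎

ballSum-zero : ∀ {d k} (v : HVertex d k) G → ballSum 0 v G ≡ G v
ballSum-zero []          G = refl
ballSum-zero {suc d} {k} (b ∷ v) G =
  trans (sum-cong-≗ {k} slice) (∑-when-≟ b (λ a → G (a ∷ v)))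
  where
  slice : ∀ a → ∑V (λ u → when (does (hamming (a ∷ u) (b ∷ v) ≤? 0)) (G (a ∷ u)))
                ≡ when (does (a ≟ b)) (G (a ∷ v))
  slice a with a ≟ b
  ... | yes _ = ballSum-zero v (λ u → G (a ∷ u))
  ... | no  _ = ∑V-zero {d}

does-suc≤?1 : ∀ m → does (suc m ≤? 1) ≡ does (m ≤? 0)
does-suc≤?1 zero    = refl
does-suc≤?1 (suc m) = refl

ballSum-one-cons : ∀ {d k} (b : Fin k) (v : HVertex d k) G →
  ballSum 1 (b ∷ v) G
    ≡ ∑[ a < k ] (if does (a ≟ b) then ballSum 1 v (λ u → G (a ∷ u)) else G (a ∷ v))
ballSum-one-cons {d} {k} b v G = sum-cong-≗ {k} slice
  where
  slice : ∀ a → ∑V (λ u → when (does (hamming (a ∷ u) (b ∷ v) ≤? 1)) (G (a ∷ u)))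
                ≡ (if does (a ≟ b) then ballSum 1 v (λ u → G (a ∷ u)) else G (a ∷ v))
  slice a with a ≟ b
  ... | yes _ = refl
  ... | no  _ = trans (∑V-cong (λ u → cong (λ β → when β (G (a ∷ u))) (does-suc≤?1 (hamming u v))))
                      (ballSum-zero v (λ u → G (a ∷ u)))

ballSum-one-const : ∀ {d k'} (v : HVertex d (suc k')) x → ballSum 1 v (λ _ → x) ≡ (1 + d * k') * x
ballSum-one-const []                  x = sym (+-identityʳ x)
ballSum-one-const {suc d} {k'} (b ∷ v) x = +-cancelʳ-≡ x _ _ (begin
  ballSum 1 (b ∷ v) (λ _ → x) + x
    ≡⟨ cong (_+ x) (ballSum-one-cons b v (λ _ → x)) ⟩
  ∑[ a < suc k' ] (if does (a ≟ b) then ballSum 1 v (λ _ → x) else x) + x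
    ≡⟨ ∑-if-≟ b (λ _ → ballSum 1 v (λ _ → x)) (λ _ → x) ⟩
  ballSum 1 v (λ _ → x) + ∑[ a < suc k' ] x
    ≡⟨ cong₂ _+_ (ballSum-one-const v x) (∑-const (suc k') x) ⟩
  (1 + d * k') * x + suc k' * x
    ≡⟨ regroup d k' x ⟩
  (1 + suc d * k') * x + x
    ∎)
  where
  regroup : ∀ d k' x → (1 + d * k') * x + suc k' * x ≡ (1 + suc d * k') * x + x
  regroup = solve-∀

∑-closedNbhdColorCount : ∀ {d k'} (c : HVertex d (suc k') → Fin (suc k')) v →
  ∑[ i < suc k' ] closedNbhdColorCount c v i ≡ 1 + d * k'
∑-closedNbhdColorCount {d} {k'} c v = begin
  ∑[ i < suc k' ] closedNbhdColorCount c v i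
    ≡⟨ sum-cong-≗ {suc k'} (closedNbhdColorCount≡ballSum c v) ⟩
  ∑[ i < suc k' ] ballSum 1 v (λ u → when (does (c u ≟ i)) 1)
    ≡⟨ ∑-∑V-comm (λ i u → when (inN[v] u) (when (does (c u ≟ i)) 1)) ⟩
  ∑V (λ u → ∑[ i < suc k' ] when (inN[v] u) (when (does (c u ≟ i)) 1))
    ≡⟨ ∑V-cong (λ u → ∑-when-colour (inN[v] u) (c u)) ⟩
  ballSum 1 v (λ _ → 1)
    ≡⟨ ballSum-one-const v 1 ⟩
  (1 + d * k') * 1
    ≡⟨ *-identityʳ _ ⟩
  1 + d * k'
    ∎
  where
  inN[v] : HVertex d (suc k') → Bool
  inN[v] u = does (hamming u v ≤? 1)
  ∑-when-colour : ∀ β j → ∑[ i < suc k' ] when β (when (does (j ≟ i)) 1) ≡ when β 1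
  ∑-when-colour true  j = trans (sum-cong-≗ {suc k'} (λ i → cong (λ β → when β 1) (does-≟-sym j i)))
                                (∑-when-≟ j (λ _ → 1))
  ∑-when-colour false j = sum-replicate-zero (suc k')

CNBalancedColorable : ℕ → ℕ → Set
CNBalancedColorable d k = ∃ λ (c : HVertex d k → Fin k) → IsCNBalancedColoring d k c

colorable⇒∣ : ∀ {d' k'} → CNBalancedColorable (suc d') (suc k') → suc k' ∣ d'
colorable⇒∣ {d'} {k'} (c , balanced) =
  ∣m+n∣m⇒∣n (divides (suc d') (k*m+d'≡[1+d']*k)) (divides m (*-comm (suc k') m))
  where
  v₀ = replicate (suc d') zero
  m  = closedNbhdColorCount c v₀ zero
  k*m≡|N[v₀]| : suc k' * m ≡ 1 + suc d' * k'
  k*m≡|N[v₀]| = begin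
    suc k' * m                                  ≡⟨ ∑-const (suc k') m ⟨
    ∑[ i < suc k' ] m                           ≡⟨ sum-cong-≗ {suc k'} (λ i → balanced v₀ i zero) ⟨
    ∑[ i < suc k' ] closedNbhdColorCount c v₀ i ≡⟨ ∑-closedNbhdColorCount c v₀ ⟩
    1 + suc d' * k'                             ∎
  k*m+d'≡[1+d']*k : suc k' * m + d' ≡ suc d' * suc k'
  k*m+d'≡[1+d']*k = trans (cong (_+ d') k*m≡|N[v₀]|) (regroup d' k')
    where
    regroup : ∀ d' k' → 1 + suc d' * k' + d' ≡ suc d' * suc k'
    regroup = solve-∀

prefixSum : ∀ {k} t {z} → HVertex (t + z) k → ℕ
prefixSum zero    u       = 0
prefixSum (suc t) (a ∷ u) = toℕ a + prefixSum t u

-- The line argument for an arbitrary k-periodic weight F, with t · F (prefixSum t v) moved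
-- to the left so that no subtraction occurs.
ballSum-one-prefixSum : ∀ {k'} {F : ℕ → ℕ} → Periodic (suc k') F →
  ∀ t {z} (v : HVertex (t + z) (suc k')) →
  ballSum 1 v (F ∘ prefixSum t) + t * F (prefixSum t v)
    ≡ (1 + z * k') * F (prefixSum t v) + t * ∑[ a < suc k' ] F (toℕ a)
ballSum-one-prefixSum F-periodic zero v = cong (_+ 0) (ballSum-one-const v _)
ballSum-one-prefixSum {k'} {F} F-periodic (suc t) {z} (b ∷ v) = begin
  ballSum 1 (b ∷ v) (F ∘ prefixSum (suc t)) + (Y + t * Y)
    ≡⟨ cong (_+ (Y + t * Y)) (ballSum-one-cons b v (F ∘ prefixSum (suc t))) ⟩
  ∑[ a < k ] (if does (a ≟ b) then E a else F (toℕ a + x)) + (Y + t * Y)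
    ≡⟨ +-assoc _ Y (t * Y) ⟨
  ∑[ a < k ] (if does (a ≟ b) then E a else F (toℕ a + x)) + Y + t * Y
    ≡⟨ cong (_+ t * Y) (∑-if-≟ b E (λ a → F (toℕ a + x))) ⟩
  E b + ∑[ a < k ] F (toℕ a + x) + t * Y
    ≡⟨ cong (λ s → E b + s + t * Y) (∑-periodic-shift F-periodic x) ⟩
  E b + S + t * Y
    ≡⟨ xy∙z≈xz∙y (E b) S (t * Y) ⟩
  E b + t * Y + S
    ≡⟨ cong (_+ S) (ballSum-one-prefixSum Fb-periodic t v) ⟩
  (1 + z * k') * Y + t * ∑[ a < k ] Fb (toℕ a) + S
    ≡⟨ cong (λ s → (1 + z * k') * Y + t * s + S) Fb-period-sum ⟩
  (1 + z * k') * Y + t * S + S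
    ≡⟨ xy∙z≈x∙zy ((1 + z * k') * Y) (t * S) S ⟩
  (1 + z * k') * Y + (S + t * S)
    ∎
  where
  k = suc k'
  x = prefixSum t v
  S = ∑[ a < k ] F (toℕ a)
  Fb : ℕ → ℕ
  Fb y = F (toℕ b + y)
  Y = Fb x
  E : Fin k → ℕ
  E a = ballSum 1 v (λ u → F (toℕ a + prefixSum t u))
  Fb-periodic : Periodic k Fb
  Fb-periodic n = trans (cong F (sym (+-assoc (toℕ b) n k))) (F-periodic (toℕ b + n))
  Fb-period-sum : ∑[ a < k ] Fb (toℕ a) ≡ S
  Fb-period-sum = trans (sum-cong-≗ {k} (λ a → cong F (+-comm (toℕ b) (toℕ a))))
                        (∑-periodic-shift F-periodic (toℕ b))

prefixColoring : ∀ {k'} t {z} → HVertex (t + z) (suc k') → Fin (suc k')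
prefixColoring {k'} t u = prefixSum t u mod suc k'

mod-periodic : ∀ k' n → (n + suc k') mod suc k' ≡ n mod suc k'
mod-periodic k' n = toℕ-injective (begin
  toℕ ((n + suc k') mod suc k')  ≡⟨ toℕ-fromℕ< _ ⟩
  (n + suc k') % suc k'          ≡⟨ [m+n]%n≡m%n n (suc k') ⟩
  n % suc k'                     ≡⟨ toℕ-fromℕ< _ ⟨
  toℕ (n mod suc k')             ∎)

toℕ-mod : ∀ {k'} (a : Fin (suc k')) → toℕ a mod suc k' ≡ a
toℕ-mod a = toℕ-injective (trans (toℕ-fromℕ< _) (m<n⇒m%n≡m (toℕ<n a)))

closedNbhdColorCount-prefixColoring : ∀ k' q (v : HVertex (suc (q * k') + q) (suc k')) i →
  closedNbhdColorCount (prefixColoring (suc (q * k'))) v i ≡ suc (q * k')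
closedNbhdColorCount-prefixColoring k' q v i = +-cancelʳ-≡ (T * Fᵢ x) _ _ (begin
  closedNbhdColorCount (prefixColoring T) v i + T * Fᵢ x
    ≡⟨ cong (_+ T * Fᵢ x) (closedNbhdColorCount≡ballSum (prefixColoring T) v i) ⟩
  ballSum 1 v (Fᵢ ∘ prefixSum T) + T * Fᵢ x
    ≡⟨ ballSum-one-prefixSum Fᵢ-periodic T v ⟩
  T * Fᵢ x + T * ∑[ a < k ] Fᵢ (toℕ a)
    ≡⟨ cong (λ s → T * Fᵢ x + T * s) Fᵢ-period-sum ⟩
  T * Fᵢ x + T * 1
    ≡⟨ cong (T * Fᵢ x +_) (*-identityʳ T) ⟩
  T * Fᵢ x + T
    ≡⟨ +-comm (T * Fᵢ x) T ⟩
  T + T * Fᵢ x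
    ∎)
  where
  k = suc k'
  T = suc (q * k')
  x = prefixSum T v
  Fᵢ : ℕ → ℕ
  Fᵢ n = when (does (n mod k ≟ i)) 1
  Fᵢ-periodic : Periodic k Fᵢ
  Fᵢ-periodic n = cong (λ a → when (does (a ≟ i)) 1) (mod-periodic k' n)
  Fᵢ-period-sum : ∑[ a < k ] Fᵢ (toℕ a) ≡ 1
  Fᵢ-period-sum = trans (sum-cong-≗ {k} (λ a → cong (λ b → when (does (b ≟ i)) 1) (toℕ-mod a)))
                        (∑-when-≟ i (λ _ → 1))

∣⇒colorable : ∀ {d' k'} → suc k' ∣ d' → CNBalancedColorable (suc d') (suc k')
∣⇒colorable {d'} {k'} (divides q d'≡q*k) = subst (λ d → CNBalancedColorable d (suc k')) T+q≡1+d'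
  (prefixColoring T , λ v i j → trans (closedNbhdColorCount-prefixColoring k' q v i)
                                      (sym (closedNbhdColorCount-prefixColoring k' q v j)))
  where
  T = suc (q * k')
  T+q≡1+d' : T + q ≡ suc d'
  T+q≡1+d' = trans (regroup q k') (cong suc (sym d'≡q*k))
    where
    regroup : ∀ q k' → suc (q * k') + q ≡ suc (q * suc k')
    regroup = solve-∀

theorem2p5 : (d k : ℕ) → 1 ≤ d → 2 ≤ k →
    (∃ λ (c : HVertex d k → Fin k) → IsCNBalancedColoring d k c)
      ⇔ (k ∣ (d ∸ 1))
-- The bound 2 ≤ k only rules out k = 0: for k = 1 both sides hold.
theorem2p5 (suc d') (suc k') _ _ = mk⇔ colorable⇒∣ ∣⇒colorable
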